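{- Let $a\in\mathbb{Z}_{+}$, let $n\ge m$ be positive integers, let $\sigma_X,\sigma_Y,\ell_X,\ell_Y$ be positive integers, let $X_1,\ldots,X_n\in[0..\sigma_X)^{\ell_X}$ and $Y_1,\ldots,Y_m\in[0..\sigma_Y)^{\ell_Y}$. Let $\mathtt{A}=\sigma_Y$, $\mathtt{B}=\sigma_Y+1$, $\ell=\ell_Y$, and $X=\bigodot_{i=1}^n(\mathtt{A}^{2\ell}\cdot X_i\cdot\mathtt{A}^{\ell}\cdot\mathtt{B}^{\ell})$, $Y=\mathtt{B}^{n\ell}\cdot\bigodot_{j=1}^m(\mathtt{A}^{\ell}\cdot Y_j\cdot\mathtt{B}^{\ell})\cdot\mathtt{B}^{n\ell}$. Then every $\delta\in[0..n-m]$ satisfies $D^+_a(X,Y)\le\frac1a(n+m)\ell+\sum_{j=1}^m D^+_a(X_{j+\delta},Y_j)$.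
   Context: Characters are nonnegative integers; $[0..\sigma)^\ell$ is the set of length-$\ell$ strings over $\{0,\ldots,\sigma-1\}$; $\bigodot$ and $\cdot$ denote concatenation and $c^m$ denotes $m$ copies of character $c$. For $a\ge1$, $\mathtt{ED}_a(X,Y)$ is the minimum total cost of edit operations transforming $X$ into $Y$, where insertions and deletions cost $1$ and substitutions cost $\frac1a$. $D_a(X,Y)=\mathtt{ED}_a(X,Y)+|Y|-|X|$, and $D^+_a(X,Y)=D_a(\$^{|Y|}\cdot X\cdot\$^{|Y|},Y)$ where $\$$ is a fresh character not occurring in any of the strings involved. -}

module Defs where

open import Data.Nat as ℕ using (ℕ; zero; suc; _≤_; _<_; _∸_; _⊔_)
open import Data.Nat.Properties using (≤-trans; +-monoˡ-<; +-comm; ≤-reflexive)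
open import Data.Integer using (+_)
open import Data.Rational using (ℚ; 0ℚ; _+_; _-_; _/_; _⊓_)
open import Data.List using (List; []; _∷_; length; replicate; _++_; concat; map; allFin; foldr)
open import Data.Fin using (Fin; toℕ; fromℕ<; fromℕ)
open import Data.Fin.Properties using (toℕ<n)
open import Data.Vec using (Vec; toList)
open import Relation.Nullary using (yes; no)
open import Relation.Binary.PropositionalEquality using (_≡_; refl)

Str : Set
Str = List ℕ

str : ∀ {σ ℓ} → Vec (Fin σ) ℓ → Str
str v = toList (Data.Vec.map toℕ v)

_^^_ : ℕ → ℕ → Str
c ^^ k = replicate k c

-- weighted edit distance ED_a: insertions/deletions cost 1, substitutions cost 1/a
-- (matching equal characters costs 0); standard dynamic-programming recursion
-- for the minimum cost of an edit sequence.
module _ (a : ℕ) .{{_ : ℕ.NonZero a}} where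
  subCost : ℕ → ℕ → ℚ
  subCost x y with x ℕ.≟ y
  ... | yes _ = 0ℚ
  ... | no _  = (+ 1) / a

  ED : Str → Str → ℚ
  ED [] ys = (+ length ys) / 1
  ED (x ∷ xs) [] = (+ length (x ∷ xs)) / 1
  ED (x ∷ xs) (y ∷ ys) =
    ((ED xs ys + subCost x y) ⊓ (ED xs (y ∷ ys) + (+ 1) / 1)) ⊓ (ED (x ∷ xs) ys + (+ 1) / 1)

  D : Str → Str → ℚ
  D X Y = ED X Y + (+ length Y) / 1 - (+ length X) / 1

  -- a character not occurring in X or Y: one more than the maximum character
  fresh : Str → Str → ℕ
  fresh X Y = suc (foldr _⊔_ 0 (X ++ Y))

  D⁺ : Str → Str → ℚ
  D⁺ X Y = D ((fresh X Y ^^ length Y) ++ X ++ (fresh X Y ^^ length Y)) Y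

⨀ : (n : ℕ) → (Fin n → Str) → Str
⨀ n f = concat (map f (allFin n))

Σℚ : (m : ℕ) → (Fin m → ℚ) → ℚ
Σℚ m f = foldr _+_ 0ℚ (map f (allFin m))

-- the (0-based) index j + δ in Fin n, given δ + m ≤ n and j < m
shift : ∀ {m n} (δ : ℕ) → δ ℕ.+ m ≤ n → Fin m → Fin n
shift {m} {n} δ h j = fromℕ< {toℕ j ℕ.+ δ}
  (≤-trans (≤-reflexive (cong-suc (+-comm (toℕ j) δ))) (≤-trans (Data.Nat.Properties.+-monoʳ-< δ (toℕ<n j)) h))
  where
  cong-suc : ∀ {x y} → x ≡ y → suc x ≡ suc y
  cong-suc refl = refl

{-# OPTIONS --safe #-}
-- D_a(X, Y) = ED_a(X, Y) + |Y| - |X| is subadditive under concatenation, and in it a deletion is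
-- free, a substitution costs at most 1/a and a match nothing; so it suffices to cut X and Y into
-- aligned pieces. Against Y = B^{nℓ} · ⨀_j (A^ℓ Y_j B^ℓ) · B^{nℓ}, the left padding $^{|Y|} is
-- substituted onto the first (n - δ)ℓ B's and the right padding onto the last (δ + m)ℓ, costing
-- (n + m)ℓ/a; the gadget of X_i for i < δ or i ≥ δ + m is deleted down to its final B^ℓ for free;
-- and the gadget A^{2ℓ} X_{j+δ} A^ℓ B^ℓ is aligned with A^ℓ Y_j B^ℓ by matching an A^ℓ and the B^ℓ,
-- leaving A^ℓ X_{j+δ} A^ℓ against Y_j, which costs D⁺(X_{j+δ}, Y_j) since A, like $, is absent from Y_j.
module Submission where

open import Defs
open import Data.Nat using (ℕ; zero; suc; _≤_; _<_; _∸_; _*_; _⊔_; NonZero; s≤s)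
open import Data.Nat using () renaming (_+_ to _+ℕ_)
import Data.Nat.Properties as ℕ
open import Data.Integer as ℤ using (+_)
import Data.Integer.Properties as ℤ
open import Data.Integer.Solver renaming (module +-*-Solver to ℤ-Solver)
open import Data.Rational using (ℚ; _+_; _-_; _/_; _⊓_; 0ℚ; 1ℚ; fromℚᵘ; toℚᵘ) renaming (_≤_ to _≤ℚ_)
import Data.Rational.Properties as ℚ
import Data.Rational.Unnormalised as ℚᵘ
import Data.Rational.Unnormalised.Properties as ℚᵘ
open import Data.Rational.Solver renaming (module +-*-Solver to ℚ-Solver)
open import Data.List using ([]; _∷_; [_]; length; replicate; _++_; concat; map; allFin; foldr)
import Data.List.Properties as List
open import Data.List.Relation.Unary.All as All using (All; []; _∷_)
import Data.List.Relation.Unary.All.Properties as All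
open import Data.List.Relation.Binary.Pointwise as Pointwise using (Pointwise; []; _∷_; Pointwise-length)
open import Data.Fin as Fin using (Fin; toℕ)
import Data.Fin.Properties as Fin
open import Data.Vec as Vec using (Vec)
import Data.Vec.Properties as Vec
import Data.Vec.Relation.Unary.All as VecAll
import Data.Vec.Relation.Unary.All.Properties as VecAll
open import Data.Product using (_×_; _,_)
open import Data.Sum using (_⊎_; inj₁; inj₂)
open import Function using (_∘_; id)
open import Relation.Nullary using (¬_; yes; no; contradiction)
open import Relation.Unary using (_∩_)
open import Relation.Binary.PropositionalEquality using (_≡_; _≢_; refl; sym; trans; cong; cong₂; subst; module ≡-Reasoning)

fromℚᵘ-homo-+ : ∀ p q → fromℚᵘ (p ℚᵘ.+ q) ≡ fromℚᵘ p + fromℚᵘ q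
fromℚᵘ-homo-+ p q = ℚ.toℚᵘ-injective (begin
  toℚᵘ (fromℚᵘ (p ℚᵘ.+ q))             ≈⟨ ℚ.toℚᵘ-fromℚᵘ (p ℚᵘ.+ q) ⟩
  p ℚᵘ.+ q                             ≈⟨ ℚᵘ.+-cong (ℚ.toℚᵘ-fromℚᵘ p) (ℚ.toℚᵘ-fromℚᵘ q) ⟨
  toℚᵘ (fromℚᵘ p) ℚᵘ.+ toℚᵘ (fromℚᵘ q) ≈⟨ ℚ.toℚᵘ-homo-+ (fromℚᵘ p) (fromℚᵘ q) ⟨
  toℚᵘ (fromℚᵘ p + fromℚᵘ q)           ∎)
  where open ℚᵘ.≃-Reasoning

/-distribʳ-+ : ∀ d .{{_ : NonZero d}} m n → (+ (m +ℕ n)) / d ≡ (+ m) / d + (+ n) / d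
/-distribʳ-+ d@(suc k) m n = trans (ℚ.fromℚᵘ-cong {w} {u ℚᵘ.+ v} (ℚᵘ.*≡* cross)) (fromℚᵘ-homo-+ u v)
  where
  open ℤ-Solver
  u = ℚᵘ.mkℚᵘ (+ m) k
  v = ℚᵘ.mkℚᵘ (+ n) k
  w = ℚᵘ.mkℚᵘ (+ (m +ℕ n)) k
  cross : (+ m ℤ.+ + n) ℤ.* + (d * d) ≡ (+ m ℤ.* + d ℤ.+ + n ℤ.* + d) ℤ.* + d
  cross = trans (cong ((+ m ℤ.+ + n) ℤ.*_) (ℤ.pos-* d d))
    (solve 3 (λ x y z → (x :+ y) :* (z :* z) := (x :* z :+ y :* z) :* z) refl (+ m) (+ n) (+ d))

+-distribʳ-⊓ : ∀ r p q → (p ⊓ q) + r ≡ (p + r) ⊓ (q + r)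
+-distribʳ-⊓ r = ℚ.mono-≤-distrib-⊓ {f = _+ r} (ℚ.+-monoˡ-≤ r)

≤-+-rightComm : ∀ {u} p q r → u ≤ℚ p + q → u + r ≤ℚ (p + r) + q
≤-+-rightComm p q r u≤p+q = ℚ.≤-trans (ℚ.+-monoˡ-≤ r u≤p+q) (ℚ.≤-reflexive (rightComm p q r))
  where
  open ℚ-Solver
  rightComm : ∀ p q r → (p + q) + r ≡ (p + r) + q
  rightComm = solve 3 (λ p q r → (p :+ q) :+ r := (p :+ r) :+ q) refl

lengthℚ : Str → ℚ
lengthℚ xs = (+ length xs) / 1

lengthℚ-++ : ∀ xs ys → lengthℚ (xs ++ ys) ≡ lengthℚ xs + lengthℚ ys
lengthℚ-++ xs ys = trans (cong (λ k → (+ k) / 1) (List.length-++ xs)) (/-distribʳ-+ 1 (length xs) (length ys))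

lengthℚ-∷ : ∀ x xs → lengthℚ (x ∷ xs) ≡ lengthℚ xs + 1ℚ
lengthℚ-∷ x xs = trans (lengthℚ-++ [ x ] xs) (ℚ.+-comm 1ℚ (lengthℚ xs))

replicate-+ : ∀ {A : Set} m n (x : A) → replicate (m +ℕ n) x ≡ replicate m x ++ replicate n x
replicate-+ zero    n x = refl
replicate-+ (suc m) n x = cong (x ∷_) (replicate-+ m n x)

replicate-*-∸ : ∀ {k n} → k ≤ n → ∀ ℓ (c : ℕ) → c ^^ (n * ℓ) ≡ (c ^^ ((n ∸ k) * ℓ)) ++ (c ^^ (k * ℓ))
replicate-*-∸ {k} {n} k≤n ℓ c = begin
  c ^^ (n * ℓ)                            ≡⟨ cong (λ j → c ^^ (j * ℓ)) (ℕ.m∸n+n≡m k≤n) ⟨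
  c ^^ ((n ∸ k +ℕ k) * ℓ)                 ≡⟨ cong (c ^^_) (ℕ.*-distribʳ-+ ℓ (n ∸ k) k) ⟩
  c ^^ ((n ∸ k) * ℓ +ℕ k * ℓ)             ≡⟨ replicate-+ ((n ∸ k) * ℓ) (k * ℓ) c ⟩
  (c ^^ ((n ∸ k) * ℓ)) ++ (c ^^ (k * ℓ))  ∎
  where open ≡-Reasoning

padding-split : ∀ {δ m n} → δ +ℕ m ≤ n → ∀ ℓ (c : ℕ) M →
  (c ^^ (n * ℓ)) ++ M ++ (c ^^ (n * ℓ)) ≡
  (c ^^ ((n ∸ δ) * ℓ)) ++ (c ^^ (δ * ℓ)) ++ M ++ (c ^^ ((n ∸ (δ +ℕ m)) * ℓ)) ++ (c ^^ ((δ +ℕ m) * ℓ))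
padding-split {δ} {m} {n} δ+m≤n ℓ c M =
  trans (cong₂ (λ u v → u ++ M ++ v) (replicate-*-∸ δ≤n ℓ c) (replicate-*-∸ δ+m≤n ℓ c))
        (List.++-assoc (c ^^ ((n ∸ δ) * ℓ)) (c ^^ (δ * ℓ)) _)
  where δ≤n = ℕ.≤-trans (ℕ.m≤m+n δ m) δ+m≤n

padding-length : ∀ {δ m n} → δ +ℕ m ≤ n → ∀ ℓ → (n ∸ δ) * ℓ +ℕ (δ +ℕ m) * ℓ ≡ (n +ℕ m) * ℓ
padding-length {δ} {m} {n} δ+m≤n ℓ = begin
  (n ∸ δ) * ℓ +ℕ (δ +ℕ m) * ℓ ≡⟨ ℕ.*-distribʳ-+ ℓ (n ∸ δ) (δ +ℕ m) ⟨
  (n ∸ δ +ℕ (δ +ℕ m)) * ℓ     ≡⟨ cong (_* ℓ) (ℕ.+-assoc (n ∸ δ) δ m) ⟨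
  (n ∸ δ +ℕ δ +ℕ m) * ℓ       ≡⟨ cong (λ k → (k +ℕ m) * ℓ) (ℕ.m∸n+n≡m (ℕ.≤-trans (ℕ.m≤m+n δ m) δ+m≤n)) ⟩
  (n +ℕ m) * ℓ                ∎
  where open ≡-Reasoning

map-allFin-suc : ∀ {A : Set} {n} (f : Fin (suc n) → A) → map f (allFin (suc n)) ≡ f Fin.zero ∷ map (f ∘ Fin.suc) (allFin n)
map-allFin-suc f = cong (f Fin.zero ∷_) (trans (List.map-tabulate Fin.suc f) (sym (List.map-tabulate id (f ∘ Fin.suc))))

⨀-suc : ∀ {n} (f : Fin (suc n) → Str) → ⨀ (suc n) f ≡ f Fin.zero ++ ⨀ n (f ∘ Fin.suc)
⨀-suc f = cong concat (map-allFin-suc f)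

Σℚ-suc : ∀ {m} (c : Fin (suc m) → ℚ) → Σℚ (suc m) c ≡ c Fin.zero + Σℚ m (c ∘ Fin.suc)
Σℚ-suc c = cong (foldr _+_ 0ℚ) (map-allFin-suc c)

toℕ-shift : ∀ {m n} δ (δ+m≤n : δ +ℕ m ≤ n) (j : Fin m) → toℕ (shift δ δ+m≤n j) ≡ δ +ℕ toℕ j
toℕ-shift δ _ j = trans (Fin.toℕ-fromℕ< _) (ℕ.+-comm (toℕ j) δ)

length-str : ∀ {σ ℓ} (v : Vec (Fin σ) ℓ) → length (str v) ≡ ℓ
length-str v = Vec.length-toList (Vec.map toℕ v)

str-< : ∀ {σ ℓ} (v : Vec (Fin σ) ℓ) → All (_< σ) (str v)
str-< v = VecAll.toList⁺ (VecAll.map⁺ (VecAll.universal Fin.toℕ<n v))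

≤-foldr-⊔ : ∀ xs → All (_≤ foldr _⊔_ 0 xs) xs
≤-foldr-⊔ []       = []
≤-foldr-⊔ (x ∷ xs) = ℕ.m≤m⊔n x _ ∷ All.map (λ y≤ → ℕ.≤-trans y≤ (ℕ.m≤n⊔m x _)) (≤-foldr-⊔ xs)

xBlock : ℕ → ℕ → ℕ → Str → Str
xBlock A B ℓ xs = (A ^^ (2 * ℓ)) ++ xs ++ (A ^^ ℓ) ++ (B ^^ ℓ)

yBlock : ℕ → ℕ → ℕ → Str → Str
yBlock A B ℓ ys = (A ^^ ℓ) ++ ys ++ (B ^^ ℓ)

xBlock-split : ∀ A B ℓ xs → xBlock A B ℓ xs ≡ (A ^^ ℓ) ++ ((A ^^ ℓ) ++ xs ++ (A ^^ ℓ)) ++ (B ^^ ℓ)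
xBlock-split A B ℓ xs = begin
  (A ^^ (ℓ +ℕ (ℓ +ℕ 0))) ++ xs ++ (A ^^ ℓ) ++ (B ^^ ℓ)
    ≡⟨ cong (λ k → (A ^^ (ℓ +ℕ k)) ++ xs ++ (A ^^ ℓ) ++ (B ^^ ℓ)) (ℕ.+-identityʳ ℓ) ⟩
  (A ^^ (ℓ +ℕ ℓ)) ++ xs ++ (A ^^ ℓ) ++ (B ^^ ℓ)
    ≡⟨ cong (_++ xs ++ (A ^^ ℓ) ++ (B ^^ ℓ)) (replicate-+ ℓ ℓ A) ⟩
  ((A ^^ ℓ) ++ (A ^^ ℓ)) ++ xs ++ (A ^^ ℓ) ++ (B ^^ ℓ)
    ≡⟨ List.++-assoc (A ^^ ℓ) (A ^^ ℓ) _ ⟩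
  (A ^^ ℓ) ++ (A ^^ ℓ) ++ xs ++ (A ^^ ℓ) ++ (B ^^ ℓ)
    ≡⟨ cong ((A ^^ ℓ) ++_) (trans (List.++-assoc (A ^^ ℓ) (xs ++ (A ^^ ℓ)) (B ^^ ℓ))
                                  (cong ((A ^^ ℓ) ++_) (List.++-assoc xs (A ^^ ℓ) (B ^^ ℓ)))) ⟨
  (A ^^ ℓ) ++ ((A ^^ ℓ) ++ xs ++ (A ^^ ℓ)) ++ (B ^^ ℓ)
    ∎
  where open ≡-Reasoning

Indistinguishable : (ℕ → Set) → ℕ → ℕ → Set
Indistinguishable P c c′ = c ≡ c′ ⊎ (¬ P c × ¬ P c′)

module _ (a : ℕ) .{{_ : NonZero a}} where
  open ℚ.≤-Reasoning

  ED-[]ʳ : ∀ xs → ED a xs [] ≡ lengthℚ xs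
  ED-[]ʳ []      = refl
  ED-[]ʳ (_ ∷ _) = refl

  ED-insert-≤ : ∀ xs y ys → ED a xs (y ∷ ys) ≤ℚ ED a xs ys + 1ℚ
  ED-insert-≤ []      y ys = ℚ.≤-reflexive (lengthℚ-∷ y ys)
  ED-insert-≤ (x ∷ xs) y ys =
    ℚ.p⊓q≤q ((ED a xs ys + subCost a x y) ⊓ (ED a xs (y ∷ ys) + 1ℚ)) (ED a (x ∷ xs) ys + 1ℚ)

  ED-delete-≤ : ∀ x xs ys → ED a (x ∷ xs) ys ≤ℚ ED a xs ys + 1ℚ
  ED-delete-≤ x xs []      = ℚ.≤-reflexive (trans (lengthℚ-∷ x xs) (cong (_+ 1ℚ) (sym (ED-[]ʳ xs))))
  ED-delete-≤ x xs (y ∷ ys) =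
    ℚ.≤-trans (ℚ.p⊓q≤p (substitute ⊓ delete) (ED a (x ∷ xs) ys + 1ℚ)) (ℚ.p⊓q≤q substitute delete)
    where
    substitute = ED a xs ys + subCost a x y
    delete     = ED a xs (y ∷ ys) + 1ℚ

  ED-++-≤ : ∀ xs ys X Y → ED a (xs ++ X) (ys ++ Y) ≤ℚ ED a xs ys + ED a X Y
  ED-++-≤ [] [] X Y = ℚ.≤-reflexive (sym (ℚ.+-identityˡ _))
  ED-++-≤ [] (y ∷ ys) X Y = begin
    ED a X (y ∷ ys ++ Y)          ≤⟨ ED-insert-≤ X y (ys ++ Y) ⟩
    ED a X (ys ++ Y) + 1ℚ         ≤⟨ ≤-+-rightComm (lengthℚ ys) (ED a X Y) 1ℚ (ED-++-≤ [] ys X Y) ⟩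
    (lengthℚ ys + 1ℚ) + ED a X Y  ≡⟨ cong (_+ ED a X Y) (lengthℚ-∷ y ys) ⟨
    lengthℚ (y ∷ ys) + ED a X Y   ∎
  ED-++-≤ (x ∷ xs) [] X Y = begin
    ED a (x ∷ xs ++ X) Y          ≤⟨ ED-delete-≤ x (xs ++ X) Y ⟩
    ED a (xs ++ X) Y + 1ℚ         ≤⟨ ≤-+-rightComm (ED a xs []) (ED a X Y) 1ℚ (ED-++-≤ xs [] X Y) ⟩
    (ED a xs [] + 1ℚ) + ED a X Y  ≡⟨ cong (λ e → (e + 1ℚ) + ED a X Y) (ED-[]ʳ xs) ⟩
    (lengthℚ xs + 1ℚ) + ED a X Y  ≡⟨ cong (_+ ED a X Y) (lengthℚ-∷ x xs) ⟨
    lengthℚ (x ∷ xs) + ED a X Y   ∎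
  ED-++-≤ (x ∷ xs) (y ∷ ys) X Y = begin
    ED a (x ∷ xs ++ X) (y ∷ ys ++ Y)
      ≤⟨ ℚ.⊓-mono-≤ (ℚ.⊓-mono-≤ (≤-+-rightComm (ED a xs ys) E (subCost a x y) (ED-++-≤ xs ys X Y))
                                (≤-+-rightComm (ED a xs (y ∷ ys)) E 1ℚ (ED-++-≤ xs (y ∷ ys) X Y)))
                    (≤-+-rightComm (ED a (x ∷ xs) ys) E 1ℚ (ED-++-≤ (x ∷ xs) ys X Y)) ⟩
    ((substitute + E) ⊓ (delete + E)) ⊓ (insert + E) ≡⟨ cong (_⊓ (insert + E)) (+-distribʳ-⊓ E substitute delete) ⟨
    ((substitute ⊓ delete) + E) ⊓ (insert + E)       ≡⟨ +-distribʳ-⊓ E (substitute ⊓ delete) insert ⟨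
    ED a (x ∷ xs) (y ∷ ys) + E                       ∎
    where
    E          = ED a X Y
    substitute = ED a xs ys + subCost a x y
    delete     = ED a xs (y ∷ ys) + 1ℚ
    insert     = ED a (x ∷ xs) ys + 1ℚ

  D-++-≤ : ∀ xs ys X Y → D a (xs ++ X) (ys ++ Y) ≤ℚ D a xs ys + D a X Y
  D-++-≤ xs ys X Y = begin
    D a (xs ++ X) (ys ++ Y)
      ≡⟨ cong₂ (λ l l′ → ED a (xs ++ X) (ys ++ Y) + l - l′) (lengthℚ-++ ys Y) (lengthℚ-++ xs X) ⟩
    ED a (xs ++ X) (ys ++ Y) + (lengthℚ ys + lengthℚ Y) - (lengthℚ xs + lengthℚ X)
      ≤⟨ ℚ.+-monoˡ-≤ _ (ℚ.+-monoˡ-≤ _ (ED-++-≤ xs ys X Y)) ⟩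
    (ED a xs ys + ED a X Y) + (lengthℚ ys + lengthℚ Y) - (lengthℚ xs + lengthℚ X)
      ≡⟨ regroup (ED a xs ys) (ED a X Y) (lengthℚ ys) (lengthℚ Y) (lengthℚ xs) (lengthℚ X) ⟩
    D a xs ys + D a X Y
      ∎
    where
    open ℚ-Solver
    regroup : ∀ e E l L k K → (e + E) + (l + L) - (k + K) ≡ (e + l - k) + (E + L - K)
    regroup = solve 6 (λ e E l L k K → (e :+ E) :+ (l :+ L) :- (k :+ K) := (e :+ l :- k) :+ (E :+ L :- K)) refl

  D-[]ʳ : ∀ xs → D a xs [] ≡ 0ℚ
  D-[]ʳ xs = trans (cong (λ e → e + 0ℚ - lengthℚ xs) (ED-[]ʳ xs)) (cancel (lengthℚ xs))
    where
    open ℚ-Solver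
    cancel : ∀ l → l + 0ℚ - l ≡ 0ℚ
    cancel = solve 1 (λ l → l :+ con 0ℚ :- l := con 0ℚ) refl

  D-++ˡ-≤ : ∀ xs X Y → D a (xs ++ X) Y ≤ℚ D a X Y
  D-++ˡ-≤ xs X Y = begin
    D a (xs ++ X) Y     ≤⟨ D-++-≤ xs [] X Y ⟩
    D a xs [] + D a X Y ≡⟨ cong (_+ D a X Y) (D-[]ʳ xs) ⟩
    0ℚ + D a X Y        ≡⟨ ℚ.+-identityˡ _ ⟩
    D a X Y             ∎

  subCost-refl : ∀ x → subCost a x x ≡ 0ℚ
  subCost-refl x with x Data.Nat.≟ x
  ... | yes _   = refl
  ... | no x≢x = contradiction refl x≢x

  subCost-≢ : ∀ {x y} → x ≢ y → subCost a x y ≡ (+ 1) / a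
  subCost-≢ {x} {y} x≢y with x Data.Nat.≟ y
  ... | yes x≡y = contradiction x≡y x≢y
  ... | no _    = refl

  subCost-≤ : ∀ x y → subCost a x y ≤ℚ (+ 1) / a
  subCost-≤ x y with x Data.Nat.≟ y
  ... | yes _ = ℚ.nonNegative⁻¹ ((+ 1) / a) {{ℚ.normalize-nonNeg 1 a}}
  ... | no _  = ℚ.≤-refl

  D-∷-≤ : ∀ x y X Y → D a (x ∷ X) (y ∷ Y) ≤ℚ subCost a x y + D a X Y
  D-∷-≤ x y X Y = ℚ.≤-trans (D-++-≤ [ x ] [ y ] X Y) (ℚ.+-monoˡ-≤ (D a X Y) single)
    where
    open ℚ-Solver
    single : D a [ x ] [ y ] ≤ℚ subCost a x y
    single = begin
      ED a [ x ] [ y ] + 1ℚ - 1ℚ ≡⟨ solve 2 (λ e l → e :+ l :- l := e) refl (ED a [ x ] [ y ]) 1ℚ ⟩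
      ED a [ x ] [ y ]           ≤⟨ ℚ.≤-trans (ℚ.p⊓q≤p _ _) (ℚ.p⊓q≤p _ _) ⟩
      0ℚ + subCost a x y         ≡⟨ ℚ.+-identityˡ _ ⟩
      subCost a x y              ∎

  D-self-≤ : ∀ xs → D a xs xs ≤ℚ 0ℚ
  D-self-≤ []       = ℚ.≤-refl
  D-self-≤ (x ∷ xs) = begin
    D a (x ∷ xs) (x ∷ xs)     ≤⟨ D-∷-≤ x x xs xs ⟩
    subCost a x x + D a xs xs ≤⟨ ℚ.+-monoʳ-≤ (subCost a x x) (D-self-≤ xs) ⟩
    subCost a x x + 0ℚ        ≡⟨ cong (_+ 0ℚ) (subCost-refl x) ⟩
    0ℚ                        ∎

  D-frame-≤ : ∀ u v X Y → D a (u ++ X ++ v) (u ++ Y ++ v) ≤ℚ D a X Y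
  D-frame-≤ u v X Y = begin
    D a (u ++ X ++ v) (u ++ Y ++ v)        ≤⟨ D-++-≤ u u (X ++ v) (Y ++ v) ⟩
    D a u u + D a (X ++ v) (Y ++ v)        ≤⟨ ℚ.+-mono-≤ (D-self-≤ u) (D-++-≤ X Y v v) ⟩
    0ℚ + (D a X Y + D a v v)               ≤⟨ ℚ.+-monoʳ-≤ 0ℚ (ℚ.+-monoʳ-≤ (D a X Y) (D-self-≤ v)) ⟩
    0ℚ + (D a X Y + 0ℚ)                    ≡⟨ trans (ℚ.+-identityˡ _) (ℚ.+-identityʳ _) ⟩
    D a X Y                                ∎

  D-replicate-≤ : ∀ c d {K k} → k ≤ K → D a (c ^^ K) (d ^^ k) ≤ℚ (+ k) / a
  D-replicate-≤ c d {K} {zero} _ = ℚ.≤-reflexive (trans (D-[]ʳ (c ^^ K)) (sym (ℚ.0/n≡0 a)))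
  D-replicate-≤ c d {suc K} {suc k} (s≤s k≤K) = begin
    D a (c ^^ suc K) (d ^^ suc k)           ≤⟨ D-∷-≤ c d (c ^^ K) (d ^^ k) ⟩
    subCost a c d + D a (c ^^ K) (d ^^ k)   ≤⟨ ℚ.+-mono-≤ (subCost-≤ c d) (D-replicate-≤ c d k≤K) ⟩
    (+ 1) / a + (+ k) / a                   ≡⟨ /-distribʳ-+ a 1 k ⟨
    (+ suc k) / a                           ∎

  subCost-cong : ∀ {P c c′ y} → Indistinguishable P c c′ → P y → subCost a c y ≡ subCost a c′ y
  subCost-cong (inj₁ refl) _ = refl
  subCost-cong {P} {c} {c′} {y} (inj₂ (c∉P , c′∉P)) y∈P =
    trans (subCost-≢ {c} {y} (λ { refl → c∉P y∈P })) (sym (subCost-≢ {c′} {y} (λ { refl → c′∉P y∈P })))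

  ED-cong : ∀ {P X X′ Y} → Pointwise (Indistinguishable P) X X′ → All P Y → ED a X Y ≡ ED a X′ Y
  ED-cong []       _ = refl
  ED-cong (_ ∷ X~X′) [] = cong (λ k → (+ suc k) / 1) (Pointwise-length X~X′)
  ED-cong (c~c′ ∷ X~X′) (y∈P ∷ Y⊆P) =
    cong₂ _⊓_ (cong₂ _⊓_ (cong₂ _+_ (ED-cong X~X′ Y⊆P) (subCost-cong c~c′ y∈P))
                         (cong (_+ 1ℚ) (ED-cong X~X′ (y∈P ∷ Y⊆P))))
              (cong (_+ 1ℚ) (ED-cong (c~c′ ∷ X~X′) Y⊆P))

  D-cong : ∀ {P X X′ Y} → Pointwise (Indistinguishable P) X X′ → All P Y → D a X Y ≡ D a X′ Y
  D-cong {Y = Y} X~X′ Y⊆P =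
    cong₂ (λ e l → e + lengthℚ Y - l) (ED-cong X~X′ Y⊆P) (cong (λ k → (+ k) / 1) (Pointwise-length X~X′))

  <-fresh : ∀ xs ys → All (_< fresh a xs ys) ys
  <-fresh xs ys = All.map s≤s (All.++⁻ʳ xs (≤-foldr-⊔ (xs ++ ys)))

  D-xBlock-≤-0 : ∀ A B ℓ xs → D a (xBlock A B ℓ xs) (B ^^ ℓ) ≤ℚ 0ℚ
  D-xBlock-≤-0 A B ℓ xs =
    ℚ.≤-trans (D-++ˡ-≤ (A ^^ (2 * ℓ)) _ _) (ℚ.≤-trans (D-++ˡ-≤ xs _ _)
      (ℚ.≤-trans (D-++ˡ-≤ (A ^^ ℓ) _ _) (D-self-≤ (B ^^ ℓ))))

  D-xBlock-yBlock-≤-D⁺ : ∀ A B ℓ xs ys → length ys ≡ ℓ → All (_< A) ys →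
    D a (xBlock A B ℓ xs) (yBlock A B ℓ ys) ≤ℚ D⁺ a xs ys
  D-xBlock-yBlock-≤-D⁺ A B _ xs ys refl ys<A = begin
    D a (xBlock A B ℓ xs) (yBlock A B ℓ ys)                       ≡⟨ cong (λ u → D a u (yBlock A B ℓ ys)) (xBlock-split A B ℓ xs) ⟩
    D a ((A ^^ ℓ) ++ fenced A ++ (B ^^ ℓ)) (yBlock A B ℓ ys)     ≤⟨ D-frame-≤ (A ^^ ℓ) (B ^^ ℓ) (fenced A) ys ⟩
    D a (fenced A) ys                                             ≡⟨ D-cong fences (All.zip (ys<A , <-fresh xs ys)) ⟩
    D⁺ a xs ys                                                    ∎
    where
    ℓ = length ys
    $ = fresh a xs ys
    fenced : ℕ → Str
    fenced c = (c ^^ ℓ) ++ xs ++ (c ^^ ℓ)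
    outside : Indistinguishable ((_< A) ∩ (_< $)) A $
    outside = inj₂ ((λ (A<A , _) → ℕ.n≮n A A<A) , (λ (_ , $<$) → ℕ.n≮n $ $<$))
    fences : Pointwise (Indistinguishable ((_< A) ∩ (_< $))) (fenced A) (fenced $)
    fences = Pointwise.++⁺ (Pointwise.replicate⁺ outside ℓ)
               (Pointwise.++⁺ (Pointwise.refl (inj₁ refl)) (Pointwise.replicate⁺ outside ℓ))

  D-⨀-++-≤ : ∀ {n} (f : Fin (suc n) → Str) v V S T →
    D a (⨀ (suc n) f ++ S) ((v ++ V) ++ T) ≤ℚ D a (f Fin.zero) v + D a (⨀ n (f ∘ Fin.suc) ++ S) (V ++ T)
  D-⨀-++-≤ {n} f v V S T = begin
    D a (⨀ (suc n) f ++ S) ((v ++ V) ++ T)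
      ≡⟨ cong₂ (D a) (trans (cong (_++ S) (⨀-suc f)) (List.++-assoc (f Fin.zero) _ S)) (List.++-assoc v V T) ⟩
    D a (f Fin.zero ++ ⨀ n (f ∘ Fin.suc) ++ S) (v ++ V ++ T)
      ≤⟨ D-++-≤ (f Fin.zero) v _ _ ⟩
    D a (f Fin.zero) v + D a (⨀ n (f ∘ Fin.suc) ++ S) (V ++ T)
      ∎

  D-skipBlocks-≤ : ∀ {n} B ℓ (f : Fin n → Str) → (∀ i → D a (f i) (B ^^ ℓ) ≤ℚ 0ℚ) → ∀ S T →
    D a (⨀ n f ++ S) ((B ^^ (n * ℓ)) ++ T) ≤ℚ D a S T
  D-skipBlocks-≤ {zero}  B ℓ f skip S T = ℚ.≤-refl
  D-skipBlocks-≤ {suc n} B ℓ f skip S T = begin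
    D a (⨀ (suc n) f ++ S) ((B ^^ (ℓ +ℕ n * ℓ)) ++ T)
      ≡⟨ cong (λ u → D a (⨀ (suc n) f ++ S) (u ++ T)) (replicate-+ ℓ (n * ℓ) B) ⟩
    D a (⨀ (suc n) f ++ S) (((B ^^ ℓ) ++ (B ^^ (n * ℓ))) ++ T)
      ≤⟨ D-⨀-++-≤ f (B ^^ ℓ) _ S T ⟩
    D a (f Fin.zero) (B ^^ ℓ) + D a (⨀ n (f ∘ Fin.suc) ++ S) ((B ^^ (n * ℓ)) ++ T)
      ≤⟨ ℚ.+-mono-≤ (skip Fin.zero) (D-skipBlocks-≤ B ℓ (f ∘ Fin.suc) (skip ∘ Fin.suc) S T) ⟩
    0ℚ + D a S T
      ≡⟨ ℚ.+-identityˡ _ ⟩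
    D a S T
      ∎

  D-matchBlocks-≤ : ∀ {n m} → m ≤ n → ∀ B ℓ (f : Fin n → Str) (g : Fin m → Str) (c : Fin m → ℚ) →
    (∀ i → D a (f i) (B ^^ ℓ) ≤ℚ 0ℚ) → (∀ i j → toℕ i ≡ toℕ j → D a (f i) (g j) ≤ℚ c j) → ∀ S T →
    D a (⨀ n f ++ S) (⨀ m g ++ (B ^^ ((n ∸ m) * ℓ)) ++ T) ≤ℚ Σℚ m c + D a S T
  D-matchBlocks-≤ {m = zero} _ B ℓ f g c skip match S T =
    ℚ.≤-trans (D-skipBlocks-≤ B ℓ f skip S T) (ℚ.≤-reflexive (sym (ℚ.+-identityˡ _)))
  D-matchBlocks-≤ {suc n} {suc m} (s≤s m≤n) B ℓ f g c skip match S T = begin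
    D a (⨀ (suc n) f ++ S) (⨀ (suc m) g ++ W)
      ≡⟨ cong (λ u → D a (⨀ (suc n) f ++ S) (u ++ W)) (⨀-suc g) ⟩
    D a (⨀ (suc n) f ++ S) ((g Fin.zero ++ ⨀ m (g ∘ Fin.suc)) ++ W)
      ≤⟨ D-⨀-++-≤ f (g Fin.zero) _ S W ⟩
    D a (f Fin.zero) (g Fin.zero) + D a (⨀ n (f ∘ Fin.suc) ++ S) (⨀ m (g ∘ Fin.suc) ++ W)
      ≤⟨ ℚ.+-mono-≤ (match Fin.zero Fin.zero refl)
                    (D-matchBlocks-≤ m≤n B ℓ (f ∘ Fin.suc) (g ∘ Fin.suc) (c ∘ Fin.suc) (skip ∘ Fin.suc)
                                     (λ i j → match (Fin.suc i) (Fin.suc j) ∘ cong suc) S T) ⟩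
    c Fin.zero + (Σℚ m (c ∘ Fin.suc) + D a S T)
      ≡⟨ ℚ.+-assoc (c Fin.zero) _ _ ⟨
    (c Fin.zero + Σℚ m (c ∘ Fin.suc)) + D a S T
      ≡⟨ cong (_+ D a S T) (Σℚ-suc c) ⟨
    Σℚ (suc m) c + D a S T
      ∎
    where W = (B ^^ ((n ∸ m) * ℓ)) ++ T

  D-shiftedBlocks-≤ : ∀ {n m} δ → δ +ℕ m ≤ n → ∀ B ℓ (f : Fin n → Str) (g : Fin m → Str) (c : Fin m → ℚ) →
    (∀ i → D a (f i) (B ^^ ℓ) ≤ℚ 0ℚ) → (∀ i j → toℕ i ≡ δ +ℕ toℕ j → D a (f i) (g j) ≤ℚ c j) → ∀ S T →
    D a (⨀ n f ++ S) ((B ^^ (δ * ℓ)) ++ ⨀ m g ++ (B ^^ ((n ∸ (δ +ℕ m)) * ℓ)) ++ T) ≤ℚ Σℚ m c + D a S T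
  D-shiftedBlocks-≤ zero = D-matchBlocks-≤
  D-shiftedBlocks-≤ {suc n} {m} (suc δ) (s≤s δ+m≤n) B ℓ f g c skip match S T = begin
    D a (⨀ (suc n) f ++ S) ((B ^^ (ℓ +ℕ δ * ℓ)) ++ W)
      ≡⟨ cong (λ u → D a (⨀ (suc n) f ++ S) (u ++ W)) (replicate-+ ℓ (δ * ℓ) B) ⟩
    D a (⨀ (suc n) f ++ S) (((B ^^ ℓ) ++ (B ^^ (δ * ℓ))) ++ W)
      ≤⟨ D-⨀-++-≤ f (B ^^ ℓ) _ S W ⟩
    D a (f Fin.zero) (B ^^ ℓ) + D a (⨀ n (f ∘ Fin.suc) ++ S) ((B ^^ (δ * ℓ)) ++ W)
      ≤⟨ ℚ.+-mono-≤ (skip Fin.zero)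
                    (D-shiftedBlocks-≤ δ δ+m≤n B ℓ (f ∘ Fin.suc) g c (skip ∘ Fin.suc)
                                       (λ i j → match (Fin.suc i) j ∘ cong suc) S T) ⟩
    0ℚ + (Σℚ m c + D a S T)
      ≡⟨ ℚ.+-identityˡ _ ⟩
    Σℚ m c + D a S T
      ∎
    where W = ⨀ m g ++ (B ^^ ((n ∸ (δ +ℕ m)) * ℓ)) ++ T

  D-paddedBlocks-≤ : ∀ {n m} δ (δ+m≤n : δ +ℕ m ≤ n) B ℓ (f : Fin n → Str) (g : Fin m → Str) (c : Fin m → ℚ) →
    (∀ i → D a (f i) (B ^^ ℓ) ≤ℚ 0ℚ) → (∀ j → D a (f (shift δ δ+m≤n j)) (g j) ≤ℚ c j) → ∀ $ →
    let Y = (B ^^ (n * ℓ)) ++ ⨀ m g ++ (B ^^ (n * ℓ)) in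
    D a (($ ^^ length Y) ++ ⨀ n f ++ ($ ^^ length Y)) Y ≤ℚ (+ ((n +ℕ m) * ℓ)) / a + Σℚ m c
  D-paddedBlocks-≤ {n} {m} δ δ+m≤n B ℓ f g c skip match $ = begin
    D a (($ ^^ L) ++ ⨀ n f ++ ($ ^^ L)) Y
      ≡⟨ cong (D a (($ ^^ L) ++ ⨀ n f ++ ($ ^^ L))) (padding-split {δ} {m} δ+m≤n ℓ B (⨀ m g)) ⟩
    D a (($ ^^ L) ++ ⨀ n f ++ ($ ^^ L)) ((B ^^ p₁) ++ middle)
      ≤⟨ D-++-≤ ($ ^^ L) (B ^^ p₁) _ _ ⟩
    D a ($ ^^ L) (B ^^ p₁) + D a (⨀ n f ++ ($ ^^ L)) middle
      ≤⟨ ℚ.+-mono-≤ (D-replicate-≤ $ B (kℓ≤L (ℕ.m∸n≤m n δ)))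
                    (D-shiftedBlocks-≤ δ δ+m≤n B ℓ f g c skip shifted _ _) ⟩
    (+ p₁) / a + (Σℚ m c + D a ($ ^^ L) (B ^^ p₂))
      ≤⟨ ℚ.+-monoʳ-≤ ((+ p₁) / a) (ℚ.+-monoʳ-≤ (Σℚ m c) (D-replicate-≤ $ B (kℓ≤L δ+m≤n))) ⟩
    (+ p₁) / a + (Σℚ m c + (+ p₂) / a)
      ≡⟨ exchange ((+ p₁) / a) (Σℚ m c) ((+ p₂) / a) ⟩
    ((+ p₁) / a + (+ p₂) / a) + Σℚ m c
      ≡⟨ cong (_+ Σℚ m c) (trans (sym (/-distribʳ-+ a p₁ p₂)) (cong (λ k → (+ k) / a) (padding-length {δ} {m} δ+m≤n ℓ))) ⟩
    (+ ((n +ℕ m) * ℓ)) / a + Σℚ m c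
      ∎
    where
    open ℚ-Solver
    Y = (B ^^ (n * ℓ)) ++ ⨀ m g ++ (B ^^ (n * ℓ))
    L = length Y
    p₁ = (n ∸ δ) * ℓ
    p₂ = (δ +ℕ m) * ℓ
    middle = (B ^^ (δ * ℓ)) ++ ⨀ m g ++ (B ^^ ((n ∸ (δ +ℕ m)) * ℓ)) ++ (B ^^ p₂)
    kℓ≤L : ∀ {k} → k ≤ n → k * ℓ ≤ L
    kℓ≤L k≤n = ℕ.≤-trans (ℕ.*-monoˡ-≤ ℓ k≤n)
      (ℕ.≤-trans (ℕ.≤-reflexive (sym (List.length-replicate (n * ℓ)))) (List.length-++-≤ˡ (B ^^ (n * ℓ))))
    shifted : ∀ i j → toℕ i ≡ δ +ℕ toℕ j → D a (f i) (g j) ≤ℚ c j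
    shifted i j i≡δ+j = subst (λ i′ → D a (f i′) (g j) ≤ℚ c j)
      (Fin.toℕ-injective (trans (toℕ-shift δ δ+m≤n j) (sym i≡δ+j))) (match j)
    exchange : ∀ x s y → x + (s + y) ≡ (x + y) + s
    exchange = solve 3 (λ x s y → x :+ (s :+ y) := (x :+ y) :+ s) refl

lemma25 : (a : ℕ) → .{{_ : NonZero a}} → (n m : ℕ) → 1 ≤ m → m ≤ n →
    (σX σY ℓX ℓY : ℕ) → 1 ≤ σX → 1 ≤ σY → 1 ≤ ℓX → 1 ≤ ℓY →
    (Xs : Fin n → Vec (Fin σX) ℓX) → (Ys : Fin m → Vec (Fin σY) ℓY) →
    (δ : ℕ) → (hδ : δ +ℕ m ≤ n) →
    let A = σY
        B = σY +ℕ 1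
        ℓ = ℓY
        X = ⨀ n (λ i → (A ^^ (2 * ℓ)) ++ str (Xs i) ++ (A ^^ ℓ) ++ (B ^^ ℓ))
        Y = (B ^^ (n * ℓ)) ++ ⨀ m (λ j → (A ^^ ℓ) ++ str (Ys j) ++ (B ^^ ℓ)) ++ (B ^^ (n * ℓ))
    in D⁺ a X Y ≤ℚ ((+ ((n +ℕ m) * ℓ)) / a + Σℚ m (λ j → D⁺ a (str (Xs (shift δ hδ j))) (str (Ys j))))
lemma25 a n m _ _ _ σY _ ℓ _ _ _ _ Xs Ys δ hδ =
  D-paddedBlocks-≤ a δ hδ B ℓ xBlocks yBlocks costs skip match _
  where
  B = σY +ℕ 1
  xBlocks : Fin n → Str
  xBlocks i = xBlock σY B ℓ (str (Xs i))
  yBlocks : Fin m → Str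
  yBlocks j = yBlock σY B ℓ (str (Ys j))
  costs : Fin m → ℚ
  costs j = D⁺ a (str (Xs (shift δ hδ j))) (str (Ys j))
  skip : ∀ i → D a (xBlocks i) (B ^^ ℓ) ≤ℚ 0ℚ
  skip i = D-xBlock-≤-0 a σY B ℓ (str (Xs i))
  match : ∀ j → D a (xBlocks (shift δ hδ j)) (yBlocks j) ≤ℚ costs j
  match j = D-xBlock-yBlock-≤-D⁺ a σY B ℓ _ (str (Ys j)) (length-str (Ys j)) (str-< (Ys j))
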